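{- Let $v>k>i\ge 0$ be integers with $v\ge 2k$ and $(v,k,i)\neq(2k,k,0)$, and let $X=J(v,k,i)$. Then the girth of $X$ equals $3$ if and only if $v\geq 3(k-i)$.
   Context: For integers $v>k>i\ge 0$, the generalized Johnson graph $J(v,k,i)$ is the simple undirected graph whose vertices are the $k$-element subsets of a fixed $v$-element set, two vertices $A,B$ being adjacent iff $|A\cap B|=i$. The girth is the length of a shortest cycle. -}

module Defs where

open import Data.Nat using (ℕ; zero; suc; _≤_)
open import Data.Fin using (Fin; zero; suc; fromℕ; inject₁)
open import Data.Fin.Subset using (Subset; ∣_∣; _∩_)
open import Data.Product using (Σ; proj₁; _×_; ∃)
open import Relation.Binary.PropositionalEquality using (_≡_)
open import Function.Definitions using (Injective)

record Graph : Set₁ where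
  field
    Vertex : Set
    Adj    : Vertex → Vertex → Set
open Graph public

JVertex : ℕ → ℕ → Set
JVertex v k = Σ (Subset v) (λ A → ∣ A ∣ ≡ k)

J : ℕ → ℕ → ℕ → Graph
J v k i = record
  { Vertex = JVertex v k
  ; Adj    = λ A B → ∣ proj₁ A ∩ proj₁ B ∣ ≡ i
  }

-- cyclic successor on Fin n:  j ↦ j+1 mod n
next : {n : ℕ} → Fin n → Fin n
next {suc n} j = go n j
  where
  go : (m : ℕ) → Fin (suc m) → Fin (suc m)
  go zero    zero    = zero
  go (suc m) zero    = suc zero
  go (suc m) (suc j) with go m j
  ... | zero  = zero
  ... | suc r = suc (suc r)

record Cycle (G : Graph) (n : ℕ) : Set where
  field
    length≥3 : 3 ≤ n
    vert     : Fin n → Vertex G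
    distinct : Injective _≡_ _≡_ vert
    adjacent : (j : Fin n) → Adj G (vert j) (vert (next j))

HasGirth : Graph → ℕ → Set
HasGirth G g = Cycle G g × (∀ n → Cycle G n → g ≤ n)

-- A girth-3 witness is a triangle: k-sets A, B, C pairwise meeting in i points.
-- Inclusion-exclusion gives |A| + |B| + |C| ≤ |A ∪ B ∪ C| + |A ∩ B| + |B ∩ C| + |C ∩ A|,
-- i.e. 3k ≤ v + 3i. Conversely, write k = i + p and assemble a triangle from points lying
-- in none, all, exactly one or exactly two of the sets: if i ≤ p, put i points in each
-- pairwise intersection and p − i private points in each set (3p points in total);
-- if p ≤ i, put p points in each pairwise intersection and i − p in all three (2p + i ≤ 2k
-- points in total).
module Submission where

open import Defs
open import Data.Nat using (ℕ; _<_; _≤_; _*_; _∸_; _+_; zero; suc)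
open import Data.Bool using (_∧_)
open import Data.Nat.Properties
open import Data.Nat.Tactic.RingSolver using (solve-∀)
open import Data.Product using (_×_; _,_; proj₁; proj₂)
open import Data.Vec using ([]; _∷_; _++_)
open import Data.Vec.Properties using (zipWith-++)
open import Data.Fin using (Fin; zero; suc)
open import Data.Fin.Subset using (Subset; inside; outside; ∣_∣; _∩_; _∪_)
open import Data.Fin.Subset.Properties using (∣p∣≤n; ∩-idem; ∩-comm; ∩-distribʳ-∪)
open import Data.Empty using (⊥-elim)
open import Data.Sum using (inj₁; inj₂)
open import Relation.Binary.PropositionalEquality hiding (J)
open import Relation.Nullary using (¬_)
open import Function.Bundles using (_⇔_; mk⇔)

∣p++q∣≡∣p∣+∣q∣ : ∀ {m n} (p : Subset m) (q : Subset n) → ∣ p ++ q ∣ ≡ ∣ p ∣ + ∣ q ∣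
∣p++q∣≡∣p∣+∣q∣ []            q = refl
∣p++q∣≡∣p∣+∣q∣ (inside  ∷ p) q = cong suc (∣p++q∣≡∣p∣+∣q∣ p q)
∣p++q∣≡∣p∣+∣q∣ (outside ∷ p) q = ∣p++q∣≡∣p∣+∣q∣ p q

∣p∪q∣+∣p∩q∣≡∣p∣+∣q∣ : ∀ {n} (p q : Subset n) → ∣ p ∪ q ∣ + ∣ p ∩ q ∣ ≡ ∣ p ∣ + ∣ q ∣
∣p∪q∣+∣p∩q∣≡∣p∣+∣q∣ []            []            = refl
∣p∪q∣+∣p∩q∣≡∣p∣+∣q∣ (inside  ∷ p) (inside  ∷ q) =
  cong suc (trans (+-suc _ _) (trans (cong suc (∣p∪q∣+∣p∩q∣≡∣p∣+∣q∣ p q)) (sym (+-suc _ _))))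
∣p∪q∣+∣p∩q∣≡∣p∣+∣q∣ (inside  ∷ p) (outside ∷ q) = cong suc (∣p∪q∣+∣p∩q∣≡∣p∣+∣q∣ p q)
∣p∪q∣+∣p∩q∣≡∣p∣+∣q∣ (outside ∷ p) (inside  ∷ q) =
  trans (cong suc (∣p∪q∣+∣p∩q∣≡∣p∣+∣q∣ p q)) (sym (+-suc _ _))
∣p∪q∣+∣p∩q∣≡∣p∣+∣q∣ (outside ∷ p) (outside ∷ q) = ∣p∪q∣+∣p∩q∣≡∣p∣+∣q∣ p q

∣p∪q∣≤∣p∣+∣q∣ : ∀ {n} (p q : Subset n) → ∣ p ∪ q ∣ ≤ ∣ p ∣ + ∣ q ∣
∣p∪q∣≤∣p∣+∣q∣ p q = subst (∣ p ∪ q ∣ ≤_) (∣p∪q∣+∣p∩q∣≡∣p∣+∣q∣ p q) (m≤m+n _ _)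

∣p∣+∣q∣+∣r∣≤n+∣p∩q∣+∣q∩r∣+∣r∩p∣ : ∀ {n} (p q r : Subset n) →
  ∣ p ∣ + ∣ q ∣ + ∣ r ∣ ≤ n + (∣ p ∩ q ∣ + ∣ q ∩ r ∣ + ∣ r ∩ p ∣)
∣p∣+∣q∣+∣r∣≤n+∣p∩q∣+∣q∩r∣+∣r∩p∣ {n} p q r = begin
  ∣ p ∣ + ∣ q ∣ + ∣ r ∣
    ≡⟨ cong (_+ ∣ r ∣) (∣p∪q∣+∣p∩q∣≡∣p∣+∣q∣ p q) ⟨
  ∣ p ∪ q ∣ + ∣ p ∩ q ∣ + ∣ r ∣
    ≡⟨ +-comm-middle (∣ p ∪ q ∣) (∣ p ∩ q ∣) (∣ r ∣) ⟩
  ∣ p ∪ q ∣ + ∣ r ∣ + ∣ p ∩ q ∣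
    ≡⟨ cong (_+ ∣ p ∩ q ∣) (∣p∪q∣+∣p∩q∣≡∣p∣+∣q∣ (p ∪ q) r) ⟨
  ∣ (p ∪ q) ∪ r ∣ + ∣ (p ∪ q) ∩ r ∣ + ∣ p ∩ q ∣
    ≡⟨ cong (λ (s : Subset n) → ∣ (p ∪ q) ∪ r ∣ + ∣ s ∣ + ∣ p ∩ q ∣) (∩-distribʳ-∪ r p q) ⟩
  ∣ (p ∪ q) ∪ r ∣ + ∣ (p ∩ r) ∪ (q ∩ r) ∣ + ∣ p ∩ q ∣
    ≤⟨ +-monoˡ-≤ (∣ p ∩ q ∣)
         (+-mono-≤ (∣p∣≤n ((p ∪ q) ∪ r)) (∣p∪q∣≤∣p∣+∣q∣ (p ∩ r) (q ∩ r))) ⟩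
  n + (∣ p ∩ r ∣ + ∣ q ∩ r ∣) + ∣ p ∩ q ∣
    ≡⟨ cong (λ (s : Subset n) → n + (∣ s ∣ + ∣ q ∩ r ∣) + ∣ p ∩ q ∣) (∩-comm p r) ⟩
  n + (∣ r ∩ p ∣ + ∣ q ∩ r ∣) + ∣ p ∩ q ∣
    ≡⟨ rearrange n (∣ r ∩ p ∣) (∣ q ∩ r ∣) (∣ p ∩ q ∣) ⟩
  n + (∣ p ∩ q ∣ + ∣ q ∩ r ∣ + ∣ r ∩ p ∣)
    ∎
  where
  open ≤-Reasoning
  +-comm-middle : ∀ a b c → a + b + c ≡ a + c + b
  +-comm-middle = solve-∀
  rearrange : ∀ a b c d → a + (b + c) + d ≡ a + (d + c + b)
  rearrange = solve-∀

record Triangle (v k i : ℕ) : Set where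
  field
    A B C   : Subset v
    ∣A∣≡k   : ∣ A ∣ ≡ k
    ∣B∣≡k   : ∣ B ∣ ≡ k
    ∣C∣≡k   : ∣ C ∣ ≡ k
    ∣A∩B∣≡i : ∣ A ∩ B ∣ ≡ i
    ∣B∩C∣≡i : ∣ B ∩ C ∣ ≡ i
    ∣C∩A∣≡i : ∣ C ∩ A ∣ ≡ i
open Triangle

triangle⇒3[k∸i]≤v : ∀ {v k i} → Triangle v k i → 3 * (k ∸ i) ≤ v
triangle⇒3[k∸i]≤v {v} {k} {i} t = begin
  3 * (k ∸ i)           ≡⟨ *-distribˡ-∸ 3 k i ⟩
  3 * k ∸ 3 * i         ≤⟨ m≤n+o⇒m∸n≤o (3 * k) (3 * i) bound ⟩
  v                     ∎
  where
  open ≤-Reasoning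
  triple : ∀ n → n + n + n ≡ 3 * n
  triple = solve-∀
  counted : k + k + k ≤ v + (i + i + i)
  counted = subst₂ _≤_
    (cong₂ _+_ (cong₂ _+_ (∣A∣≡k t) (∣B∣≡k t)) (∣C∣≡k t))
    (cong (v +_) (cong₂ _+_ (cong₂ _+_ (∣A∩B∣≡i t) (∣B∩C∣≡i t)) (∣C∩A∣≡i t)))
    (∣p∣+∣q∣+∣r∣≤n+∣p∩q∣+∣q∩r∣+∣r∩p∣ (A t) (B t) (C t))
  bound : 3 * k ≤ 3 * i + v
  bound = subst₂ _≤_ (triple k) (trans (cong (v +_) (triple i)) (+-comm v (3 * i))) counted

resize : ∀ {v k i v′ k′ i′} → Triangle v k i → v ≡ v′ → k ≡ k′ → i ≡ i′ → Triangle v′ k′ i′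
resize t refl refl refl = t

∅ᵀ : Triangle 0 0 0
∅ᵀ = record { A = [] ; B = [] ; C = []
            ; ∣A∣≡k = refl ; ∣B∣≡k = refl ; ∣C∣≡k = refl
            ; ∣A∩B∣≡i = refl ; ∣B∩C∣≡i = refl ; ∣C∩A∣≡i = refl }

_⊕_ : ∀ {v k i v′ k′ i′} → Triangle v k i → Triangle v′ k′ i′ → Triangle (v + v′) (k + k′) (i + i′)
s ⊕ t = record
  { A = A s ++ A t ; B = B s ++ B t ; C = C s ++ C t
  ; ∣A∣≡k = size (A s) (A t) (∣A∣≡k s) (∣A∣≡k t)
  ; ∣B∣≡k = size (B s) (B t) (∣B∣≡k s) (∣B∣≡k t)
  ; ∣C∣≡k = size (C s) (C t) (∣C∣≡k s) (∣C∣≡k t)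
  ; ∣A∩B∣≡i = meet (A s) (A t) (B s) (B t) (∣A∩B∣≡i s) (∣A∩B∣≡i t)
  ; ∣B∩C∣≡i = meet (B s) (B t) (C s) (C t) (∣B∩C∣≡i s) (∣B∩C∣≡i t)
  ; ∣C∩A∣≡i = meet (C s) (C t) (A s) (A t) (∣C∩A∣≡i s) (∣C∩A∣≡i t)
  }
  where
  size : ∀ {m n a b} (p : Subset m) (q : Subset n) → ∣ p ∣ ≡ a → ∣ q ∣ ≡ b → ∣ p ++ q ∣ ≡ a + b
  size p q refl refl = ∣p++q∣≡∣p∣+∣q∣ p q
  meet : ∀ {m n a b} (p : Subset m) (q : Subset n) (p′ : Subset m) (q′ : Subset n) →
         ∣ p ∩ p′ ∣ ≡ a → ∣ q ∩ q′ ∣ ≡ b → ∣ (p ++ q) ∩ (p′ ++ q′) ∣ ≡ a + b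
  meet p q p′ q′ hp hq rewrite zipWith-++ _∧_ p q p′ q′ = size (p ∩ p′) (q ∩ q′) hp hq

replicateᵀ : ∀ n {v k i} → Triangle v k i → Triangle (n * v) (n * k) (n * i)
replicateᵀ zero    t = ∅ᵀ
replicateᵀ (suc n) t = t ⊕ replicateᵀ n t

unusedᵀ : Triangle 1 0 0
unusedᵀ = record { A = outside ∷ [] ; B = outside ∷ [] ; C = outside ∷ []
                 ; ∣A∣≡k = refl ; ∣B∣≡k = refl ; ∣C∣≡k = refl
                 ; ∣A∩B∣≡i = refl ; ∣B∩C∣≡i = refl ; ∣C∩A∣≡i = refl }

commonᵀ : Triangle 1 1 1
commonᵀ = record { A = inside ∷ [] ; B = inside ∷ [] ; C = inside ∷ []
                 ; ∣A∣≡k = refl ; ∣B∣≡k = refl ; ∣C∣≡k = refl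
                 ; ∣A∩B∣≡i = refl ; ∣B∩C∣≡i = refl ; ∣C∩A∣≡i = refl }

privateᵀ : Triangle 3 1 0
privateᵀ = record { A = inside ∷ outside ∷ outside ∷ []
                  ; B = outside ∷ inside ∷ outside ∷ []
                  ; C = outside ∷ outside ∷ inside ∷ []
                  ; ∣A∣≡k = refl ; ∣B∣≡k = refl ; ∣C∣≡k = refl
                  ; ∣A∩B∣≡i = refl ; ∣B∩C∣≡i = refl ; ∣C∩A∣≡i = refl }

pairwiseᵀ : Triangle 3 2 1
pairwiseᵀ = record { A = inside ∷ outside ∷ inside ∷ []
                   ; B = inside ∷ inside ∷ outside ∷ []
                   ; C = outside ∷ inside ∷ inside ∷ []
                   ; ∣A∣≡k = refl ; ∣B∣≡k = refl ; ∣C∣≡k = refl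
                   ; ∣A∩B∣≡i = refl ; ∣B∩C∣≡i = refl ; ∣C∩A∣≡i = refl }

triangle-exists : ∀ {v i p} → 3 * p ≤ v → 2 * (i + p) ≤ v → Triangle v (i + p) i
triangle-exists {i = i} {p} 3p≤v 2k≤v with ≤-total i p
... | inj₁ i≤p with m≤n⇒∃[o]m+o≡n i≤p
...   | s , refl with m≤n⇒∃[o]m+o≡n 3p≤v
...     | e , refl = resize
          (replicateᵀ e unusedᵀ ⊕ (replicateᵀ s privateᵀ ⊕ replicateᵀ i pairwiseᵀ))
          (size e s i) (degree e s i) (meet e s i)
  where
  size : ∀ e s i → e * 1 + (s * 3 + i * 3) ≡ 3 * (i + s) + e
  size = solve-∀
  degree : ∀ e s i → e * 0 + (s * 1 + i * 2) ≡ i + (i + s)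
  degree = solve-∀
  meet : ∀ e s i → e * 0 + (s * 0 + i * 1) ≡ i
  meet = solve-∀
triangle-exists {i = i} {p} 3p≤v 2k≤v | inj₂ p≤i with m≤n⇒∃[o]m+o≡n p≤i
...   | x , refl with m≤n⇒∃[o]m+o≡n 2k≤v
...     | e , refl = resize
          (replicateᵀ (p + x + e) unusedᵀ ⊕ (replicateᵀ x commonᵀ ⊕ replicateᵀ p pairwiseᵀ))
          (size e x p) (degree e x p) (meet e x p)
  where
  size : ∀ e x p → (p + x + e) * 1 + (x * 1 + p * 3) ≡ 2 * (p + x + p) + e
  size = solve-∀
  degree : ∀ e x p → (p + x + e) * 0 + (x * 1 + p * 2) ≡ p + x + p
  degree = solve-∀
  meet : ∀ e x p → (p + x + e) * 0 + (x * 1 + p * 1) ≡ p + x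
  meet = solve-∀

adjacent⇒≢ : ∀ {v k i} {p q : Subset v} → i < k → ∣ p ∣ ≡ k → ∣ p ∩ q ∣ ≡ i → p ≢ q
adjacent⇒≢ {p = p} i<k ∣p∣≡k ∣p∩q∣≡i refl =
  <⇒≢ i<k (trans (sym ∣p∩q∣≡i) (trans (cong ∣_∣ (∩-idem p)) ∣p∣≡k))

triangle⇒cycle : ∀ {v k i} → i < k → Triangle v k i → Cycle (J v k i) 3
triangle⇒cycle {v} {k} {i} i<k t = record
  { length≥3 = ≤-refl ; vert = vertex ; distinct = injective ; adjacent = adjacent }
  where
  vertex : Fin 3 → JVertex v k
  vertex zero             = A t , ∣A∣≡k t
  vertex (suc zero)       = B t , ∣B∣≡k t
  vertex (suc (suc zero)) = C t , ∣C∣≡k t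
  adjacent : (j : Fin 3) → Adj (J v k i) (vertex j) (vertex (next j))
  adjacent zero             = ∣A∩B∣≡i t
  adjacent (suc zero)       = ∣B∩C∣≡i t
  adjacent (suc (suc zero)) = ∣C∩A∣≡i t
  A≢B : A t ≢ B t
  A≢B = adjacent⇒≢ i<k (∣A∣≡k t) (∣A∩B∣≡i t)
  B≢C : B t ≢ C t
  B≢C = adjacent⇒≢ i<k (∣B∣≡k t) (∣B∩C∣≡i t)
  C≢A : C t ≢ A t
  C≢A = adjacent⇒≢ i<k (∣C∣≡k t) (∣C∩A∣≡i t)
  injective : ∀ {a b} → vertex a ≡ vertex b → a ≡ b
  injective {zero}             {zero}             _ = refl
  injective {suc zero}         {suc zero}         _ = refl
  injective {suc (suc zero)}   {suc (suc zero)}   _ = refl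
  injective {zero}             {suc zero}         e = ⊥-elim (A≢B (cong proj₁ e))
  injective {suc zero}         {zero}             e = ⊥-elim (A≢B (cong proj₁ (sym e)))
  injective {suc zero}         {suc (suc zero)}   e = ⊥-elim (B≢C (cong proj₁ e))
  injective {suc (suc zero)}   {suc zero}         e = ⊥-elim (B≢C (cong proj₁ (sym e)))
  injective {suc (suc zero)}   {zero}             e = ⊥-elim (C≢A (cong proj₁ e))
  injective {zero}             {suc (suc zero)}   e = ⊥-elim (C≢A (cong proj₁ (sym e)))

cycle⇒triangle : ∀ {v k i} → Cycle (J v k i) 3 → Triangle v k i
cycle⇒triangle c = record
  { A = proj₁ (vert zero) ; B = proj₁ (vert (suc zero)) ; C = proj₁ (vert (suc (suc zero)))
  ; ∣A∣≡k = proj₂ (vert zero) ; ∣B∣≡k = proj₂ (vert (suc zero))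
  ; ∣C∣≡k = proj₂ (vert (suc (suc zero)))
  ; ∣A∩B∣≡i = adjacent zero ; ∣B∩C∣≡i = adjacent (suc zero) ; ∣C∩A∣≡i = adjacent (suc (suc zero))
  }
  where open Cycle c

-- The hypotheses k < v and (v,k,i) ≠ (2k,k,0) only ensure that the girth is defined
-- (J(2k,k,0) is a perfect matching); the equivalence holds without them.
lemma2p2 : (v k i : ℕ) → i < k → k < v → 2 * k ≤ v →
           ¬ ((v ≡ 2 * k) × (i ≡ 0)) →
           HasGirth (J v k i) 3 ⇔ (3 * (k ∸ i) ≤ v)
lemma2p2 v k i i<k _ 2k≤v _ = mk⇔
  (λ (cycle , _) → triangle⇒3[k∸i]≤v (cycle⇒triangle cycle))
  (λ 3[k∸i]≤v → triangle⇒cycle i<k (triangle 3[k∸i]≤v) , λ _ c → Cycle.length≥3 c)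
  where
  k≡i+[k∸i] : k ≡ i + (k ∸ i)
  k≡i+[k∸i] = sym (m+[n∸m]≡n (<⇒≤ i<k))
  triangle : 3 * (k ∸ i) ≤ v → Triangle v k i
  triangle 3[k∸i]≤v = resize
    (triangle-exists 3[k∸i]≤v (subst (λ n → 2 * n ≤ v) k≡i+[k∸i] 2k≤v))
    refl (sym k≡i+[k∸i]) refl
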